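{- Let $\mathcal G=\{G_1,\dots,G_t\}$ be graphs on a common vertex set $V$. If each $G_i$ is $(p,\beta)$-jumbled, then $\mathcal G$ is a $(p,\beta\sqrt t)$-jumbled graph family, i.e. for all $X\subseteq V\times[t]$ and $Y\subseteq V$, $|e_{B_{\mathcal G}}(X,Y)-p|X||Y||\le\beta\sqrt{t}\,|X|^{1/2}|Y|^{1/2}$.
   Context: For a graph $G$ and $X,Y\subseteq V(G)$, $e(X,Y)=\#\{(x,y)\in X\times Y:xy\in E(G)\}$; $G$ is $(p,\beta)$-jumbled ($0<p<1\le\beta$) if $|e(X,Y)-p|X||Y||\le\beta|X|^{1/2}|Y|^{1/2}$ for all $X,Y\subseteq V(G)$. The auxiliary bipartite graph $B_{\mathcal G}$ has parts $V\times[t]$ and $V$, with $(u,i)$ adjacent to $v$ iff $uv\in E(G_i)$; $e_{B_{\mathcal G}}(X,Y)$ counts pairs $(x,y)\in X\times Y$ adjacent in $B_{\mathcal G}$.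
   Formalization: The parameters p and β range over the rationals rather than the reals. -}

module Defs where

open import Data.Bool using (Bool; true; false; _∧_)
open import Data.Nat using (ℕ; zero; suc)
import Data.Nat as ℕ
open import Data.Fin using (Fin)
import Data.Fin as F
open import Data.Integer using (+_)
open import Data.Rational using (ℚ; _/_; _*_; _-_; _≤_)
open import Relation.Binary.PropositionalEquality using (_≡_)

∑ : ∀ {m} → (Fin m → ℕ) → ℕ
∑ {zero}  f = 0
∑ {suc m} f = f F.zero ℕ.+ ∑ (λ i → f (F.suc i))

χ : Bool → ℕ
χ true  = 1
χ false = 0

⟦_⟧ : ℕ → ℚ
⟦ n ⟧ = + n / 1

record Graph (n : ℕ) : Set where
  field
    adj    : Fin n → Fin n → Bool
    sym    : ∀ u v → adj u v ≡ adj v u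
    irrefl : ∀ v → adj v v ≡ false
open Graph public

VSet : ℕ → Set
VSet n = Fin n → Bool

-- subsets of V × [t]
VTSet : ℕ → ℕ → Set
VTSet n t = Fin n → Fin t → Bool

∣_∣V : ∀ {n} → VSet n → ℕ
∣ X ∣V = ∑ (λ u → χ (X u))

∣_∣VT : ∀ {n t} → VTSet n t → ℕ
∣ X ∣VT = ∑ (λ u → ∑ (λ i → χ (X u i)))

eG : ∀ {n} → Graph n → VSet n → VSet n → ℕ
eG G X Y = ∑ (λ u → ∑ (λ v → χ (X u ∧ (Y v ∧ adj G u v))))

-- e_{B_𝒢}(X,Y): (u,i) ∈ X, v ∈ Y, uv ∈ E(G_i)
eB : ∀ {n t} → (Fin t → Graph n) → VTSet n t → VSet n → ℕ
eB 𝒢 X Y = ∑ (λ u → ∑ (λ i → ∑ (λ v → χ (X u i ∧ (Y v ∧ adj (𝒢 i) u v)))))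

-- (p,β)-jumbled, with both sides of
--   |e(X,Y) - p|X||Y|| ≤ β |X|^{1/2} |Y|^{1/2}
-- squared (both sides are nonnegative, so this is equivalent and avoids √)
Jumbled : ∀ {n} → ℚ → ℚ → Graph n → Set
Jumbled p β G = ∀ (X Y : VSet _) →
  let d = ⟦ eG G X Y ⟧ - p * ⟦ ∣ X ∣V ⟧ * ⟦ ∣ Y ∣V ⟧ in
  d * d ≤ β * β * ⟦ ∣ X ∣V ⟧ * ⟦ ∣ Y ∣V ⟧

-- 𝒢 is a (p, β√t)-jumbled family; squared: (β√t)² = β² t
FamilyJumbledSqrtT : ∀ {n t} → ℚ → ℚ → (Fin t → Graph n) → Set
FamilyJumbledSqrtT {n} {t} p β 𝒢 = ∀ (X : VTSet n t) (Y : VSet n) →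
  let d = ⟦ eB 𝒢 X Y ⟧ - p * ⟦ ∣ X ∣VT ⟧ * ⟦ ∣ Y ∣V ⟧ in
  d * d ≤ β * β * ⟦ t ⟧ * ⟦ ∣ X ∣VT ⟧ * ⟦ ∣ Y ∣V ⟧

-- Writing X_i = {u : (u , i) ∈ X}, we have e_B(X , Y) = Σᵢ e_{G_i}(X_i , Y) and
-- |X| = Σᵢ |X_i|, so the discrepancy d = e_B(X , Y) - p|X||Y| is the sum of the
-- discrepancies d_i of the G_i on (X_i , Y).  Cauchy–Schwarz gives
-- d² ≤ t Σᵢ d_i² ≤ t Σᵢ β²|X_i||Y| = β² t |X||Y|.
module Submission where

open import Defs
open import Data.Nat using (ℕ)
open import Data.Fin using (Fin)
open import Data.Rational using (ℚ; 0ℚ; 1ℚ; _<_; _≤_)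

open import Algebra.Bundles using (Ring)
import Algebra.Properties.CommutativeMonoid.Sum as CommutativeMonoidSum
import Algebra.Properties.Semiring.Sum as SemiringSum
open import Data.Bool using (_∧_)
open import Data.Fin using (zero; suc)
import Data.Integer as ℤ
import Data.Integer.Properties as ℤ
import Data.Nat as ℕ
import Data.Nat.Coprimality as Coprimality
import Data.Nat.Properties as ℕ
open import Data.Rational using (mkℚ; _+_; _*_; _-_; nonNegative; nonPositive)
open import Data.Rational.Properties
  using (normalize-coprime; normalize-nonNeg; /-cong; +-*-ring; +-identityˡ; *-distribˡ-+;
         ≤-refl; ≤-reflexive; ≤-total; +-mono-≤; *-monoˡ-≤-nonNeg;
         nonNegative⁻¹; nonNeg*nonNeg⇒nonNeg; nonPos*nonPos⇒nonPos;
         module ≤-Reasoning)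
open import Data.Rational.Solver using (module +-*-Solver)
open import Data.Sum using (inj₁; inj₂)
open import Data.Vec.Functional using (Vector)
open import Function using (_∘_; flip)
open import Relation.Binary.PropositionalEquality as ≡
  using (_≡_; refl; cong; cong₂; module ≡-Reasoning)

module ℕΣ = CommutativeMonoidSum ℕ.+-0-commutativeMonoid
open SemiringSum (Ring.semiring +-*-ring) using (sum; *-distribˡ-sum; *-distribʳ-sum)
open +-*-Solver using (solve; _:=_; _:+_; _:*_; _:-_; con)

∑≡sum : ∀ {m} (f : Fin m → ℕ) → ∑ f ≡ ℕΣ.sum f
∑≡sum {ℕ.zero}  f = refl
∑≡sum {ℕ.suc m} f = cong (f zero ℕ.+_) (∑≡sum (f ∘ suc))

∑∑≡sum-sum : ∀ {m k} (f : Fin m → Fin k → ℕ) →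
             ∑ (λ u → ∑ (f u)) ≡ ℕΣ.sum (λ u → ℕΣ.sum (f u))
∑∑≡sum-sum f =
  ≡.trans (∑≡sum (λ u → ∑ (f u))) (ℕΣ.sum-cong-≗ (λ u → ∑≡sum (f u)))

∑-comm : ∀ {m k} (f : Fin m → Fin k → ℕ) → ∑ (λ u → ∑ (f u)) ≡ ∑ (λ i → ∑ (λ u → f u i))
∑-comm f = ≡.trans (∑∑≡sum-sum f)
                   (≡.trans (ℕΣ.∑-comm f) (≡.sym (∑∑≡sum-sum (flip f))))

slice : ∀ {n t} → VTSet n t → Fin t → VSet n
slice X i u = X u i

eB≡∑eG-slice : ∀ {n t} (𝒢 : Fin t → Graph n) X Y →
               eB 𝒢 X Y ≡ ∑ (λ i → eG (𝒢 i) (slice X i) Y)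
eB≡∑eG-slice 𝒢 X Y = ∑-comm (λ u i → ∑ (λ v → χ (X u i ∧ (Y v ∧ adj (𝒢 i) u v))))

∣∣VT≡∑∣slice∣V : ∀ {n t} (X : VTSet n t) → ∣ X ∣VT ≡ ∑ (λ i → ∣ slice X i ∣V)
∣∣VT≡∑∣slice∣V X = ∑-comm (λ u i → χ (X u i))

-- ⟦ n ⟧ = normalize n 1 is stuck for variable n; in this form _+_ computes on it.
⟦⟧≡mkℚ : ∀ n → ⟦ n ⟧ ≡ mkℚ (ℤ.+ n) 0 (Coprimality.sym (Coprimality.1-coprimeTo n))
⟦⟧≡mkℚ n = normalize-coprime _

⟦⟧-homo-+ : ∀ a b → ⟦ a ℕ.+ b ⟧ ≡ ⟦ a ⟧ + ⟦ b ⟧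
⟦⟧-homo-+ a b = ≡.sym (≡.trans (cong₂ _+_ (⟦⟧≡mkℚ a) (⟦⟧≡mkℚ b))
  (/-cong (cong₂ ℤ._+_ (ℤ.*-identityʳ (ℤ.+ a)) (ℤ.*-identityʳ (ℤ.+ b))) refl))

⟦suc⟧ : ∀ n → ⟦ ℕ.suc n ⟧ ≡ 1ℚ + ⟦ n ⟧
⟦suc⟧ = ⟦⟧-homo-+ 1

⟦⟧-homo-∑ : ∀ {m} (f : Fin m → ℕ) → ⟦ ∑ f ⟧ ≡ sum (⟦_⟧ ∘ f)
⟦⟧-homo-∑ {ℕ.zero}  f = refl
⟦⟧-homo-∑ {ℕ.suc m} f =
  ≡.trans (⟦⟧-homo-+ (f zero) _) (cong (⟦ f zero ⟧ +_) (⟦⟧-homo-∑ (f ∘ suc)))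

*-⟦∑⟧-* : ∀ {m} a (f : Fin m → ℕ) b → a * ⟦ ∑ f ⟧ * b ≡ sum (λ i → a * ⟦ f i ⟧ * b)
*-⟦∑⟧-* a f b = begin
  a * ⟦ ∑ f ⟧ * b                 ≡⟨ cong (λ s → a * s * b) (⟦⟧-homo-∑ f) ⟩
  a * sum (⟦_⟧ ∘ f) * b           ≡⟨ cong (_* b) (*-distribˡ-sum a (⟦_⟧ ∘ f)) ⟩
  sum (λ i → a * ⟦ f i ⟧) * b     ≡⟨ *-distribʳ-sum b (λ i → a * ⟦ f i ⟧) ⟩
  sum (λ i → a * ⟦ f i ⟧ * b)     ∎
  where open ≡-Reasoning

sum-mono-≤ : ∀ {m} {f g : Vector ℚ m} → (∀ i → f i ≤ g i) → sum f ≤ sum g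
sum-mono-≤ {ℕ.zero}  f≤g = ≤-refl
sum-mono-≤ {ℕ.suc m} f≤g = +-mono-≤ (f≤g zero) (sum-mono-≤ (f≤g ∘ suc))

0≤x² : ∀ x → 0ℚ ≤ x * x
0≤x² x with ≤-total 0ℚ x
... | inj₁ 0≤x = nonNegative⁻¹ (x * x) {{nonNeg*nonNeg⇒nonNeg x {{x≥0}} x {{x≥0}}}}
  where x≥0 = nonNegative 0≤x
... | inj₂ x≤0 = nonNegative⁻¹ (x * x) {{nonPos*nonPos⇒nonPos x {{x≤0′}} x {{x≤0′}}}}
  where x≤0′ = nonPositive x≤0

2xy≤x²+y² : ∀ x y → (x + x) * y ≤ x * x + y * y
2xy≤x²+y² x y = begin
  (x + x) * y
    ≡⟨ ≡.sym (+-identityˡ _) ⟩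
  0ℚ + (x + x) * y
    ≤⟨ +-mono-≤ (0≤x² (x - y)) ≤-refl ⟩
  (x - y) * (x - y) + (x + x) * y
    ≡⟨ solve 2 (λ x y → (x :- y) :* (x :- y) :+ (x :+ x) :* y := x :* x :+ y :* y) refl x y ⟩
  x * x + y * y ∎
  where open ≤-Reasoning

2x∑a≤tx²+∑a² : ∀ {t} x (a : Vector ℚ t) →
               (x + x) * sum a ≤ ⟦ t ⟧ * (x * x) + sum (λ i → a i * a i)
2x∑a≤tx²+∑a² {ℕ.zero}  x a =
  ≤-reflexive (solve 1 (λ x → (x :+ x) :* con 0ℚ := con 0ℚ :* (x :* x) :+ con 0ℚ) refl x)
2x∑a≤tx²+∑a² {ℕ.suc t} x a = begin
  (x + x) * (b + S)
    ≡⟨ *-distribˡ-+ (x + x) b S ⟩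
  (x + x) * b + (x + x) * S
    ≤⟨ +-mono-≤ (2xy≤x²+y² x b) (2x∑a≤tx²+∑a² x (a ∘ suc)) ⟩
  (x * x + b * b) + (⟦ t ⟧ * (x * x) + Q)
    ≡⟨ solve 4 (λ x b T Q → (x :* x :+ b :* b) :+ (T :* (x :* x) :+ Q)
                          := (con 1ℚ :+ T) :* (x :* x) :+ (b :* b :+ Q)) refl x b ⟦ t ⟧ Q ⟩
  (1ℚ + ⟦ t ⟧) * (x * x) + (b * b + Q)
    ≡⟨ cong (λ T → T * (x * x) + (b * b + Q)) (≡.sym (⟦suc⟧ t)) ⟩
  ⟦ ℕ.suc t ⟧ * (x * x) + (b * b + Q) ∎
  where
  open ≤-Reasoning
  b S Q : ℚ
  b = a zero
  S = sum (a ∘ suc)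
  Q = sum (λ i → a (suc i) * a (suc i))

cauchy-schwarz : ∀ {t} (a : Vector ℚ t) → sum a * sum a ≤ ⟦ t ⟧ * sum (λ i → a i * a i)
cauchy-schwarz {ℕ.zero}  a = ≤-refl
cauchy-schwarz {ℕ.suc t} a = begin
  (b + S) * (b + S)
    ≡⟨ solve 2 (λ b S → (b :+ S) :* (b :+ S) := b :* b :+ (b :+ b) :* S :+ S :* S) refl b S ⟩
  b * b + (b + b) * S + S * S
    ≤⟨ +-mono-≤ (+-mono-≤ (≤-refl {b * b}) (2x∑a≤tx²+∑a² b (a ∘ suc))) (cauchy-schwarz (a ∘ suc)) ⟩
  b * b + (⟦ t ⟧ * (b * b) + Q) + ⟦ t ⟧ * Q
    ≡⟨ solve 3 (λ b T Q → b :* b :+ (T :* (b :* b) :+ Q) :+ T :* Q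
                        := (con 1ℚ :+ T) :* (b :* b :+ Q)) refl b ⟦ t ⟧ Q ⟩
  (1ℚ + ⟦ t ⟧) * (b * b + Q)
    ≡⟨ cong (_* (b * b + Q)) (≡.sym (⟦suc⟧ t)) ⟩
  ⟦ ℕ.suc t ⟧ * (b * b + Q) ∎
  where
  open ≤-Reasoning
  b S Q : ℚ
  b = a zero
  S = sum (a ∘ suc)
  Q = sum (λ i → a (suc i) * a (suc i))

discrepancy : ℚ → ℕ → ℕ → ℕ → ℚ
discrepancy p e x y = ⟦ e ⟧ - p * ⟦ x ⟧ * ⟦ y ⟧

discrepancy-∑ : ∀ {t} p (e x : Fin t → ℕ) y →
  discrepancy p (∑ e) (∑ x) y ≡ sum (λ i → discrepancy p (e i) (x i) y)
discrepancy-∑ {ℕ.zero}  p e x y =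
  solve 2 (λ p Y → con 0ℚ :- p :* con 0ℚ :* Y := con 0ℚ) refl p ⟦ y ⟧
discrepancy-∑ {ℕ.suc t} p e x y = begin
  ⟦ e zero ℕ.+ ∑ (e ∘ suc) ⟧ - p * ⟦ x zero ℕ.+ ∑ (x ∘ suc) ⟧ * ⟦ y ⟧
    ≡⟨ cong₂ (λ E X → E - p * X * ⟦ y ⟧) (⟦⟧-homo-+ (e zero) _) (⟦⟧-homo-+ (x zero) _) ⟩
  (⟦ e zero ⟧ + ⟦ ∑ (e ∘ suc) ⟧) - p * (⟦ x zero ⟧ + ⟦ ∑ (x ∘ suc) ⟧) * ⟦ y ⟧
    ≡⟨ solve 6 (λ e E x X p Y → (e :+ E) :- p :* (x :+ X) :* Y
                              := (e :- p :* x :* Y) :+ (E :- p :* X :* Y))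
               refl ⟦ e zero ⟧ ⟦ ∑ (e ∘ suc) ⟧ ⟦ x zero ⟧ ⟦ ∑ (x ∘ suc) ⟧ p ⟦ y ⟧ ⟩
  discrepancy p (e zero) (x zero) y + discrepancy p (∑ (e ∘ suc)) (∑ (x ∘ suc)) y
    ≡⟨ cong (discrepancy p (e zero) (x zero) y +_) (discrepancy-∑ p (e ∘ suc) (x ∘ suc) y) ⟩
  sum (λ i → discrepancy p (e i) (x i) y) ∎
  where open ≡-Reasoning

-- The range conditions on p and β belong to the notion of jumbledness; the bound holds without them.
proposition1p1 : (n t : ℕ) (p β : ℚ) → 0ℚ < p → p < 1ℚ → 1ℚ ≤ β →
    (𝒢 : Fin t → Graph n) → (∀ i → Jumbled p β (𝒢 i)) →
    FamilyJumbledSqrtT p β 𝒢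
proposition1p1 n t p β _ _ _ 𝒢 jumbled X Y = begin
  d * d
    ≡⟨ cong (λ z → z * z) d≡∑δ ⟩
  sum δ * sum δ
    ≤⟨ cauchy-schwarz δ ⟩
  ⟦ t ⟧ * sum (λ i → δ i * δ i)
    ≤⟨ *-monoˡ-≤-nonNeg ⟦ t ⟧ {{normalize-nonNeg t 1}} (sum-mono-≤ (λ i → jumbled i (slice X i) Y)) ⟩
  ⟦ t ⟧ * sum (λ i → β * β * ⟦ x i ⟧ * ⟦ y ⟧)
    ≡⟨ cong (⟦ t ⟧ *_) (≡.sym (*-⟦∑⟧-* (β * β) x ⟦ y ⟧)) ⟩
  ⟦ t ⟧ * (β * β * ⟦ ∑ x ⟧ * ⟦ y ⟧)
    ≡⟨ solve 4 (λ T b s y → T :* (b :* b :* s :* y) := b :* b :* T :* s :* y)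
               refl ⟦ t ⟧ β ⟦ ∑ x ⟧ ⟦ y ⟧ ⟩
  β * β * ⟦ t ⟧ * ⟦ ∑ x ⟧ * ⟦ y ⟧
    ≡⟨ cong (λ s → β * β * ⟦ t ⟧ * ⟦ s ⟧ * ⟦ y ⟧) (≡.sym (∣∣VT≡∑∣slice∣V X)) ⟩
  β * β * ⟦ t ⟧ * ⟦ ∣ X ∣VT ⟧ * ⟦ y ⟧ ∎
  where
  open ≤-Reasoning
  y : ℕ
  y = ∣ Y ∣V
  x e : Fin t → ℕ
  x i = ∣ slice X i ∣V
  e i = eG (𝒢 i) (slice X i) Y
  d : ℚ
  d = discrepancy p (eB 𝒢 X Y) ∣ X ∣VT y
  δ : Vector ℚ t
  δ i = discrepancy p (e i) (x i) y
  d≡∑δ : d ≡ sum δ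
  d≡∑δ = ≡.trans
    (cong₂ (λ E S → discrepancy p E S y) (eB≡∑eG-slice 𝒢 X Y) (∣∣VT≡∑∣slice∣V X))
    (discrepancy-∑ p e x y)
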